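{- Let $r \geq 3$ and $t \geq r-2$ be integers. There is a constant $C$ (depending on $r,t$) such that the following holds. Let $(H,\mathcal{F})$ be a maximal $(r,t)$-system satisfying at least one of: (1) there is a vertex $v$ of $H$ with $d(v)+s(v) \leq t$; (2) there are distinct vertices $v,w$ of $H$ with $s(v)=s(w)=0$ and $\Gamma(v)=\Gamma(w)$. Then there exists a maximal $(r,t)$-system $(H',\mathcal{F}')$ with $|V(H')|=|V(H)|-1$, $e(H') \leq e(H)+C$ and $|\mathcal{F}|-C \leq |\mathcal{F}'| \leq |\mathcal{F}|$.
   Context: All graphs are finite and simple; $d(v)$ is the degree and $\Gamma(v)$ the neighbourhood of $v$ in $H$; $s(v)$ is the number of sets in $\mathcal{F}$ containing $v$; $e(H)$ is the number of edges. For $r\ge 3$, an $r$-system is a pair $(H,\mathcal{F})$ where $H$ is a graph and $\mathcal{F}$ is a family of subsets of $V(H)$ such that: (i) $H$ contains no $K_r$; (ii) every $S\in\mathcal{F}$ is maximally $K_{r-1}$-free ($H[S]$ has no $K_{r-1}$ but $H[S\cup\{u\}]$ has a $K_{r-1}$ for every $u\notin S$); (iii) for distinct $S\neq T$ in $\mathcal{F}$, $H[S\cap T]$ contains a $K_{r-2}$. It is maximal if for every non-edge $e$ of $H$, either $H+e$ contains $K_r$ or $(H+e)[S]$ contains $K_{r-1}$ for some $S\in\mathcal{F}$. A maximal $(r,t)$-system is a maximal $r$-system with no repeated sets in $\mathcal{F}$ and all sets of size exactly $t$. -}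

module Defs where

open import Data.Bool using (Bool; true; false; _∧_; _∨_; not)
open import Data.Bool.Properties using (∨-comm)
open import Data.Sum using (_⊎_)
open import Data.Empty using (⊥-elim)
open import Relation.Nullary using (yes; no)
open import Data.Nat using (ℕ; zero; suc; _+_; _∸_; _≤_)
open import Data.Fin using (Fin; _<?_)
open import Data.Fin.Subset using (Subset; _∈_; _∉_; _⊆_; _∩_; ∣_∣; ⁅_⁆; _∪_)
open import Data.Fin.Subset.Properties using (_∈?_)
open import Data.List using (List; length; filter; map)
open import Data.Nat.ListAction using (sum)
open import Data.List using (allFin)
open import Data.List.Relation.Unary.Unique.Propositional using (Unique)
import Data.List.Membership.Propositional as LM
open import Data.Vec using (tabulate)
open import Data.Product using (Σ; _×_; ∃)
open import Data.Empty using (⊥)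
open import Relation.Nullary using (¬_)
open import Relation.Nullary.Decidable using (⌊_⌋)
open import Relation.Binary.PropositionalEquality using (_≡_; _≢_; refl; cong₂)
open import Data.Fin using (_≟_)

record Graph (n : ℕ) : Set where
  field
    adj     : Fin n → Fin n → Bool
    sym     : ∀ x y → adj x y ≡ adj y x
    irrefl  : ∀ x → adj x x ≡ false
open Graph public

Adj : ∀ {n} → Graph n → Fin n → Fin n → Set
Adj G x y = adj G x y ≡ true

Γ : ∀ {n} → Graph n → Fin n → Subset n
Γ G v = tabulate (adj G v)

deg : ∀ {n} → Graph n → Fin n → ℕ
deg G v = ∣ Γ G v ∣

edges : ∀ {n} → Graph n → ℕ
edges {n} G = sum (map (λ x → ∣ tabulate (λ y → ⌊ x <? y ⌋ ∧ adj G x y) ∣) (allFin n))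

HasClique : ∀ {n} → Graph n → ℕ → Subset n → Set
HasClique {n} G k S =
  Σ (Subset n) λ K → (K ⊆ S) × (∣ K ∣ ≡ k) ×
    (∀ x y → x ∈ K → y ∈ K → x ≢ y → Adj G x y)

full : ∀ {n} → Subset n
full = tabulate (λ _ → true)

ContainsK : ∀ {n} → Graph n → ℕ → Set
ContainsK G k = HasClique G k full

MaxKFree : ∀ {n} → Graph n → ℕ → Subset n → Set
MaxKFree G k S = ¬ HasClique G k S × (∀ u → u ∉ S → HasClique G k (S ∪ ⁅ u ⁆))

s : ∀ {n} → List (Subset n) → Fin n → ℕ
s F v = length (filter (λ S → v ∈? S) F)

addEdge : ∀ {n} → Graph n → Fin n → Fin n → Graph n
addEdge G x y = record
  { adj = λ a b → adj G a b ∨ (isXY a b ∨ isXY b a)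
  ; sym = symP
  ; irrefl = irr }
  where
  isXY : _ → _ → Bool
  isXY a b = ⌊ a ≟ x ⌋ ∧ ⌊ b ≟ y ⌋ ∧ not ⌊ x ≟ y ⌋
  symP : ∀ a b → (adj G a b ∨ (isXY a b ∨ isXY b a)) ≡ (adj G b a ∨ (isXY b a ∨ isXY a b))
  symP a b = cong₂ _∨_ (sym G a b) (∨-comm (isXY a b) (isXY b a))
  irr : ∀ a → (adj G a a ∨ (isXY a a ∨ isXY a a)) ≡ false
  irr a with irrefl G a | a ≟ x | a ≟ y | x ≟ y
  ... | p | yes refl | yes refl | yes _ rewrite p = refl
  ... | p | yes refl | yes refl | no q = ⊥-elim (q refl)
  ... | p | yes _ | no _ | _ rewrite p = refl
  ... | p | no _ | _ | _ rewrite p = refl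

record IsRSystem {n} (r : ℕ) (H : Graph n) (F : List (Subset n)) : Set where
  field
    noKr     : ¬ ContainsK H r
    maxFree  : ∀ S → S LM.∈ F → MaxKFree H (r ∸ 1) S
    intersect : ∀ S T → S LM.∈ F → T LM.∈ F → S ≢ T → HasClique H (r ∸ 2) (S ∩ T)

IsMaximalRSystem : ∀ {n} → ℕ → Graph n → List (Subset n) → Set
IsMaximalRSystem {n} r H F =
  IsRSystem r H F ×
  (∀ x y → x ≢ y → ¬ Adj H x y →
     ContainsK (addEdge H x y) r ⊎ Σ (Subset n) λ S → S LM.∈ F × HasClique (addEdge H x y) (r ∸ 1) S)

IsMaximalRTSystem : ∀ {n} → ℕ → ℕ → Graph n → List (Subset n) → Set
IsMaximalRTSystem r t H F =
  IsMaximalRSystem r H F × Unique F × (∀ S → S LM.∈ F → ∣ S ∣ ≡ t)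

{-# OPTIONS --safe #-}

-- Delete a vertex u (u = v in case (1), u = w in case (2)) together with the s(u) sets of F through
-- it; the surviving sets, re-indexed, still form an r-system with H − u. A non-edge ij of H − u was
-- blocked in H by a K_r of H + ij or a K_{r−1} of (H + ij)[S] with S ∈ F, and that clique contains
-- i and j; it survives the deletion unless it passes through u. In case (2) a K_r through w can be
-- moved onto its twin v, and no set contains w, so H − w is already maximal. In case (1) a blocking
-- clique through v forces i and j to be neighbours of v or to share a set with v; there are at most
-- (1 + t)t such vertices, so greedily adding the non-edges among them that are still unblocked
-- restores maximality at the cost of boundedly many edges.

module Submission where

open import Defs
open import Data.Nat using (ℕ; suc; _+_; _∸_; _≤_)
open import Data.Fin using (Fin)
open import Data.Fin.Subset using (Subset)
open import Data.List using (List; length)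
open import Data.Product using (Σ; ∃; _×_)
open import Data.Sum using (_⊎_)
open import Relation.Binary.PropositionalEquality using (_≡_; _≢_)

open import Data.Bool as Bool using (Bool; true; false; _∧_)
open import Data.Nat as ℕ using (zero; _*_; z≤n; s≤s)
open import Data.Nat.Properties
  using ( ≤-refl; ≤-trans; ≤-reflexive; +-assoc; +-suc; +-mono-≤; +-monoˡ-≤; +-monoʳ-≤; *-mono-≤
        ; m≤m+n; m≤n+m; ∸-monoʳ-≤; m+n∸n≡m; <⇒≤; +-0-commutativeMonoid; module ≤-Reasoning)
open import Algebra.Properties.CommutativeMonoid.Sum +-0-commutativeMonoid
  using (sum-syntax; sum-cong-≗; sum-remove; sum-replicate-zero; ∑-distrib-+)
import Data.Nat.ListAction as ListAction
open import Data.Fin as Fin using (zero; suc; punchIn; punchOut; _<?_; _≟_)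
open import Data.Fin.Properties
  using (punchIn-injective; punchInᵢ≢i; punchIn-punchOut; punchIn-mono-≤; ≤∧≢⇒<; <⇒≢; all?)
open import Data.Fin.Subset using (_∈_; _∉_; _⊆_; _∩_; _∪_; ⁅_⁆; ∣_∣; inside; outside)
open import Data.Fin.Subset.Properties
  using (_∈?_; _⊆?_; anySubset?; x∈⁅x⁆; x∈⁅y⁆⇒x≡y; x∈p∪q⁺; x∈p∪q⁻; x∈p∩q⁺; x∈p∩q⁻)
open import Data.Vec as Vec using (Vec; []; _∷_; lookup; tabulate; removeAt; insertAt; _[_]≔_; _[_]=_)
open import Data.Vec.Properties
  using ( lookup∘tabulate; []=⇒lookup; lookup⇒[]=; lookup∘update′; []≔-updates; []=-injective
        ; insertAt-lookup; insertAt-punchIn; removeAt-insertAt; insertAt-removeAt)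
import Data.List as List
open import Data.List using ([]; _∷_; filter; concatMap; cartesianProduct)
open import Data.List.Properties using (length-++; length-map; map-tabulate)
open import Data.List.Membership.Propositional using (find; lose) renaming (_∈_ to _∈ₗ_)
open import Data.List.Membership.Propositional.Properties
  using (∈-map⁺; ∈-map⁻; ∈-filter⁺; ∈-filter⁻; ∈-concat⁺′; ∈-cartesianProduct⁺)
open import Data.List.Relation.Unary.All as All using (All; []; _∷_)
import Data.List.Relation.Unary.All.Properties as Allₚ
open import Data.List.Relation.Unary.Any using (here; there; any?)
open import Data.List.Relation.Unary.Unique.Propositional using (Unique; []; _∷_)
open import Data.List.Relation.Unary.Unique.Propositional.Properties using (filter⁺)
open import Data.Product as Product using (_,_; proj₁; proj₂)
open import Data.Sum as Sum using (inj₁; inj₂; [_,_])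
open import Data.Empty using (⊥-elim)
open import Function using (_∘_; id)
open import Relation.Nullary using (¬_; Dec; yes; no; ¬?; contradiction)
open import Relation.Nullary.Decidable
  using (⌊_⌋; _×-dec_; _⊎-dec_; _→-dec_; map′; dec-true; dec-false; isYes≗does)
open import Relation.Binary.PropositionalEquality
  using (refl; trans; cong; cong₂; subst; module ≡-Reasoning)
import Relation.Binary.PropositionalEquality as ≡

open IsRSystem

indicator : Bool → ℕ
indicator true  = 1
indicator false = 0

⌊⌋-yes : ∀ {A : Set} (a? : Dec A) → A → ⌊ a? ⌋ ≡ true
⌊⌋-yes a? a = trans (isYes≗does a?) (dec-true a? a)

⌊⌋-no : ∀ {A : Set} (a? : Dec A) → ¬ A → ⌊ a? ⌋ ≡ false
⌊⌋-no a? ¬a = trans (isYes≗does a?) (dec-false a? ¬a)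

∑-mono-≤ : ∀ {n} {f g : Fin n → ℕ} → (∀ i → f i ≤ g i) → ∑[ i < n ] f i ≤ ∑[ i < n ] g i
∑-mono-≤ {zero}  f≤g = z≤n
∑-mono-≤ {suc n} f≤g = +-mono-≤ (f≤g zero) (∑-mono-≤ (f≤g ∘ suc))

∑-punchIn-≤ : ∀ {n} (u : Fin (suc n)) (f : Fin (suc n) → ℕ) →
  ∑[ i < n ] f (punchIn u i) ≤ ∑[ a < suc n ] f a
∑-punchIn-≤ u f = ≤-trans (m≤n+m _ (f u)) (≤-reflexive (≡.sym (sum-remove {i = u} f)))

∑∑-distrib-+ : ∀ {n} (f g : Fin n → Fin n → ℕ) →
  ∑[ a < n ] ∑[ b < n ] (f a b + g a b) ≡ ∑[ a < n ] ∑[ b < n ] f a b + ∑[ a < n ] ∑[ b < n ] g a b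
∑∑-distrib-+ {n} f g = trans (sum-cong-≗ (λ a → ∑-distrib-+ (f a) (g a)))
                             (∑-distrib-+ (λ a → ∑[ b < n ] f a b) (λ a → ∑[ b < n ] g a b))

∑-indicator-≟ : ∀ {n} (x : Fin n) → ∑[ a < n ] indicator ⌊ a ≟ x ⌋ ≡ 1
∑-indicator-≟ {suc n} x = begin
  ∑[ a < suc n ] indicator ⌊ a ≟ x ⌋  ≡⟨ sum-remove {i = x} (λ a → indicator ⌊ a ≟ x ⌋) ⟩
  indicator ⌊ x ≟ x ⌋ + ∑[ i < n ] indicator ⌊ punchIn x i ≟ x ⌋
    ≡⟨ cong₂ _+_ (cong indicator (⌊⌋-yes (x ≟ x) refl))
                 (trans (sum-cong-≗ (λ i → cong indicator (⌊⌋-no (punchIn x i ≟ x) (punchInᵢ≢i x i))))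
                        (sum-replicate-zero n)) ⟩
  1 ∎
  where open ≡-Reasoning

∑∑-indicator-≟ : ∀ {n} (x y : Fin n) → ∑[ a < n ] ∑[ b < n ] indicator (⌊ a ≟ x ⌋ ∧ ⌊ b ≟ y ⌋) ≡ 1
∑∑-indicator-≟ {n} x y = trans (sum-cong-≗ (λ a → row ⌊ a ≟ x ⌋)) (∑-indicator-≟ x)
  where
  row : ∀ p → ∑[ b < n ] indicator (p ∧ ⌊ b ≟ y ⌋) ≡ indicator p
  row true  = ∑-indicator-≟ y
  row false = sum-replicate-zero n

sum-tabulate : ∀ {n} (f : Fin n → ℕ) → ListAction.sum (List.tabulate f) ≡ ∑[ i < n ] f i
sum-tabulate {zero}  f = refl
sum-tabulate {suc n} f = cong (f zero +_) (sum-tabulate (f ∘ suc))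

length-filter-¬ : ∀ {A : Set} {P : A → Set} (P? : ∀ x → Dec (P x)) xs →
  length (filter (¬? ∘ P?) xs) + length (filter P? xs) ≡ length xs
length-filter-¬ P? []       = refl
length-filter-¬ P? (x ∷ xs) with P? x
... | yes _ = trans (+-suc _ _) (cong suc (length-filter-¬ P? xs))
... | no  _ = cong suc (length-filter-¬ P? xs)

Unique-map⁺ : ∀ {A B : Set} {P : A → Set} {f : A → B} {xs} → (∀ {x y} → P x → P y → f x ≡ f y → x ≡ y) →
  All P xs → Unique xs → Unique (List.map f xs)
Unique-map⁺ injective []         []              = []
Unique-map⁺ injective (px ∷ pxs) (x∉xs ∷ unique) =
  Allₚ.map⁺ (All.zipWith (λ (x≢y , py) → x≢y ∘ injective px py) (x∉xs , pxs)) ∷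
  Unique-map⁺ injective pxs unique

length-concatMap-≤ : ∀ {A B : Set} (f : A → List B) {k} xs → All (λ x → length (f x) ≤ k) xs →
  length (concatMap f xs) ≤ length xs * k
length-concatMap-≤ f []       []             = z≤n
length-concatMap-≤ f (x ∷ xs) (fx≤k ∷ fxs≤k) =
  ≤-trans (≤-reflexive (length-++ (f x))) (+-mono-≤ fx≤k (length-concatMap-≤ f xs fxs≤k))

length-cartesianProduct : ∀ {A B : Set} (xs : List A) (ys : List B) →
  length (cartesianProduct xs ys) ≡ length xs * length ys
length-cartesianProduct []       ys = refl
length-cartesianProduct (x ∷ xs) ys =
  trans (length-++ (List.map (x ,_) ys)) (cong₂ _+_ (length-map (x ,_) ys) (length-cartesianProduct xs ys))

∣tabulate∣≡∑ : ∀ {n} (f : Fin n → Bool) → ∣ tabulate f ∣ ≡ ∑[ i < n ] indicator (f i)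
∣tabulate∣≡∑ {zero}  f = refl
∣tabulate∣≡∑ {suc n} f with f zero
... | true  = cong suc (∣tabulate∣≡∑ (f ∘ suc))
... | false = ∣tabulate∣≡∑ (f ∘ suc)

∈-full : ∀ {n} {x : Fin n} → x ∈ full
∈-full {x = x} = lookup⇒[]= x full (lookup∘tabulate _ x)

⊆-full : ∀ {n} {p : Subset n} → p ⊆ full
⊆-full _ = ∈-full

elements : ∀ {n} → Subset n → List (Fin n)
elements []            = []
elements (inside  ∷ p) = zero ∷ List.map suc (elements p)
elements (outside ∷ p) = List.map suc (elements p)

∈-elements : ∀ {n} {p : Subset n} {i} → i ∈ p → i ∈ₗ elements p
∈-elements {p = inside  ∷ p} Vec.here          = here refl
∈-elements {p = inside  ∷ p} (Vec.there i∈p) = there (∈-map⁺ suc (∈-elements i∈p))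
∈-elements {p = outside ∷ p} (Vec.there i∈p) = ∈-map⁺ suc (∈-elements i∈p)

length-elements : ∀ {n} (p : Subset n) → length (elements p) ≡ ∣ p ∣
length-elements []            = refl
length-elements (inside  ∷ p) = cong suc (trans (length-map suc (elements p)) (length-elements p))
length-elements (outside ∷ p) = trans (length-map suc (elements p)) (length-elements p)

lookup-removeAt : ∀ {A : Set} {n} (xs : Vec A (suc n)) i j →
  lookup (removeAt xs i) j ≡ lookup xs (punchIn i j)
lookup-removeAt (x ∷ xs)     zero    j       = refl
lookup-removeAt (x ∷ y ∷ xs) (suc i) zero    = refl
lookup-removeAt (x ∷ y ∷ xs) (suc i) (suc j) = lookup-removeAt (y ∷ xs) i j

module _ {n} {u : Fin (suc n)} {p : Subset (suc n)} where

  ∈-removeAt⁻ : ∀ {i} → i ∈ removeAt p u → punchIn u i ∈ p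
  ∈-removeAt⁻ {i} i∈ = lookup⇒[]= _ p (trans (≡.sym (lookup-removeAt p u i)) ([]=⇒lookup i∈))

  ∈-removeAt⁺ : ∀ {i} → punchIn u i ∈ p → i ∈ removeAt p u
  ∈-removeAt⁺ {i} i∈ = lookup⇒[]= i _ (trans (lookup-removeAt p u i) ([]=⇒lookup i∈))

∉⇒lookup≡outside : ∀ {n} {x : Fin n} {p} → x ∉ p → lookup p x ≡ outside
∉⇒lookup≡outside {x = x} {p} x∉p with lookup p x in eq
... | outside = refl
... | inside  = contradiction (lookup⇒[]= x p eq) x∉p

∣∣-removeAt : ∀ {n} (p : Subset (suc n)) i → ∣ p ∣ ≡ indicator (lookup p i) + ∣ removeAt p i ∣
∣∣-removeAt (inside  ∷ p)     zero    = refl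
∣∣-removeAt (outside ∷ p)     zero    = refl
∣∣-removeAt (inside  ∷ q ∷ p) (suc i) = trans (cong suc (∣∣-removeAt (q ∷ p) i)) (≡.sym (+-suc _ _))
∣∣-removeAt (outside ∷ q ∷ p) (suc i) = ∣∣-removeAt (q ∷ p) i

∣removeAt∣≡∣∣ : ∀ {n} {p : Subset (suc n)} {u} → u ∉ p → ∣ removeAt p u ∣ ≡ ∣ p ∣
∣removeAt∣≡∣∣ {p = p} {u} u∉p =
  ≡.sym (trans (∣∣-removeAt p u) (cong (λ b → indicator b + ∣ removeAt p u ∣) (∉⇒lookup≡outside u∉p)))

∣removeAt∣≤∣∣ : ∀ {n} (p : Subset (suc n)) u → ∣ removeAt p u ∣ ≤ ∣ p ∣
∣removeAt∣≤∣∣ p u = ≤-trans (m≤n+m _ _) (≤-reflexive (≡.sym (∣∣-removeAt p u)))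

removeAt-injective : ∀ {n} {u : Fin (suc n)} {S S′} → u ∉ S → u ∉ S′ → removeAt S u ≡ removeAt S′ u → S ≡ S′
removeAt-injective {u = u} {S} {S′} u∉S u∉S′ S⁻≡S′⁻ = begin
  S                                         ≡⟨ insertAt-removeAt S u ⟨
  insertAt (removeAt S u) u (lookup S u)    ≡⟨ cong₂ (λ T b → insertAt T u b) S⁻≡S′⁻ same-lookup ⟩
  insertAt (removeAt S′ u) u (lookup S′ u)  ≡⟨ insertAt-removeAt S′ u ⟩
  S′                                        ∎
  where
  open ≡-Reasoning
  same-lookup = trans (∉⇒lookup≡outside u∉S) (≡.sym (∉⇒lookup≡outside u∉S′))

module _ {n} {u : Fin (suc n)} {p : Subset n} where

  ∣insertAt-outside∣ : ∣ insertAt p u outside ∣ ≡ ∣ p ∣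
  ∣insertAt-outside∣ = begin
    ∣ insertAt p u outside ∣                              ≡⟨ ∣∣-removeAt (insertAt p u outside) u ⟩
    indicator (lookup (insertAt p u outside) u) + ∣ removeAt (insertAt p u outside) u ∣
      ≡⟨ cong₂ (λ b q → indicator b + ∣ q ∣) (insertAt-lookup p u outside) (removeAt-insertAt p u outside) ⟩
    ∣ p ∣                                                 ∎
    where open ≡-Reasoning

  ∈-insertAt-outside⁻ : ∀ {a} → a ∈ insertAt p u outside → ∃ λ i → punchIn u i ≡ a × i ∈ p
  ∈-insertAt-outside⁻ {a} a∈ with a ≟ u
  ... | yes refl = contradiction (trans (≡.sym ([]=⇒lookup a∈)) (insertAt-lookup p u outside)) λ ()
  ... | no a≢u   = punchOut u≢a , punchIn-punchOut u≢a , lookup⇒[]= (punchOut u≢a) p (begin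
    lookup p (punchOut u≢a)
      ≡⟨ insertAt-punchIn p u outside (punchOut u≢a) ⟨
    lookup (insertAt p u outside) (punchIn u (punchOut u≢a))
      ≡⟨ cong (lookup (insertAt p u outside)) (punchIn-punchOut u≢a) ⟩
    lookup (insertAt p u outside) a
      ≡⟨ []=⇒lookup a∈ ⟩
    inside ∎)
    where
    open ≡-Reasoning
    u≢a = a≢u ∘ ≡.sym

module _ {n} {u : Fin (suc n)} {S : Subset (suc n)} where

  ∈-removeAt-∪-⁅⁆ : ∀ {i j} → punchIn u j ∈ S ∪ ⁅ punchIn u i ⁆ → j ∈ removeAt S u ∪ ⁅ i ⁆
  ∈-removeAt-∪-⁅⁆ {i} {j} j∈ = x∈p∪q⁺ (Sum.map ∈-removeAt⁺ j∈⁅i⁆ (x∈p∪q⁻ S _ j∈))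
    where
    j∈⁅i⁆ : punchIn u j ∈ ⁅ punchIn u i ⁆ → j ∈ ⁅ i ⁆
    j∈⁅i⁆ j∈ = subst (_∈ ⁅ i ⁆) (≡.sym (punchIn-injective u j i (x∈⁅y⁆⇒x≡y _ j∈))) (x∈⁅x⁆ i)

  ∈-removeAt-∩ : ∀ {S′ j} → punchIn u j ∈ S ∩ S′ → j ∈ removeAt S u ∩ removeAt S′ u
  ∈-removeAt-∩ {S′} j∈ = x∈p∩q⁺ (Product.map ∈-removeAt⁺ ∈-removeAt⁺ (x∈p∩q⁻ S S′ j∈))

[]=-[]≔⁻ : ∀ {A : Set} {n} {xs : Vec A n} {i j x y} → i ≢ j → (xs [ j ]≔ y) [ i ]= x → xs [ i ]= x
[]=-[]≔⁻ {xs = xs} {i} {y = y} i≢j i↦x =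
  lookup⇒[]= i xs (trans (≡.sym (lookup∘update′ i≢j xs y)) ([]=⇒lookup i↦x))

∣∣-[]≔-inside : ∀ {n} (p : Subset n) i → i ∉ p → ∣ p [ i ]≔ inside ∣ ≡ suc ∣ p ∣
∣∣-[]≔-inside (outside ∷ p) zero    _   = refl
∣∣-[]≔-inside (inside  ∷ p) zero    i∉p = contradiction Vec.here i∉p
∣∣-[]≔-inside (inside  ∷ p) (suc i) i∉p = cong suc (∣∣-[]≔-inside p i (i∉p ∘ Vec.there))
∣∣-[]≔-inside (outside ∷ p) (suc i) i∉p = ∣∣-[]≔-inside p i (i∉p ∘ Vec.there)

∣∣-[]≔-outside : ∀ {n} {p : Subset n} {i} → i ∈ p → suc ∣ p [ i ]≔ outside ∣ ≡ ∣ p ∣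
∣∣-[]≔-outside                     Vec.here       = refl
∣∣-[]≔-outside {p = inside  ∷ p} (Vec.there i∈p) = cong suc (∣∣-[]≔-outside i∈p)
∣∣-[]≔-outside {p = outside ∷ p} (Vec.there i∈p) = ∣∣-[]≔-outside i∈p

∉-[]≔-outside : ∀ {n} (p : Subset n) i → i ∉ p [ i ]≔ outside
∉-[]≔-outside p i i∈ = contradiction ([]=-injective ([]≔-updates p i) i∈) λ ()

Adj-sym : ∀ {n} (G : Graph n) {a b} → Adj G a b → Adj G b a
Adj-sym G {a} {b} e = trans (Graph.sym G b a) e

Adj⇒≢ : ∀ {n} (G : Graph n) {a b} → Adj G a b → a ≢ b
Adj⇒≢ G {a} e refl = contradiction (trans (≡.sym e) (irrefl G a)) λ ()

record _⊑_ {n} (G G′ : Graph n) : Set where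
  constructor ⊑-intro
  field ⊑-adj : ∀ {a b} → Adj G a b → Adj G′ a b
open _⊑_

⊑-addEdge : ∀ {n} (G : Graph n) x y → G ⊑ addEdge G x y
⊑-addEdge G x y = ⊑-intro grow
  where
  grow : ∀ {a b} → Adj G a b → Adj (addEdge G x y) a b
  grow old rewrite old = refl

addEdge-adj⁻ : ∀ {n} (G : Graph n) x y a b → Adj (addEdge G x y) a b →
  Adj G a b ⊎ (a ≡ x × b ≡ y ⊎ a ≡ y × b ≡ x)
addEdge-adj⁻ G x y a b new with adj G a b | a ≟ x | b ≟ y | b ≟ x | a ≟ y
... | true  | _       | _       | _       | _       = inj₁ refl
... | false | yes a≡x | yes b≡y | _       | _       = inj₂ (inj₁ (a≡x , b≡y))
... | false | _       | _       | yes b≡x | yes a≡y = inj₂ (inj₂ (a≡y , b≡x))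
... | false | no _    | _       | no _    | _       = contradiction new λ ()
... | false | no _    | _       | yes _   | no _    = contradiction new λ ()
... | false | yes _   | no _    | no _    | _       = contradiction new λ ()
... | false | yes _   | no _    | yes _   | no _    = contradiction new λ ()

addEdge-adj⁻-≢ : ∀ {n} (G : Graph n) {x y a} b → a ≢ x → a ≢ y → Adj (addEdge G x y) a b → Adj G a b
addEdge-adj⁻-≢ G {x} {y} {a} b a≢x a≢y new with addEdge-adj⁻ G x y a b new
... | inj₁ old               = old
... | inj₂ (inj₁ (a≡x , _)) = contradiction a≡x a≢x
... | inj₂ (inj₂ (a≡y , _)) = contradiction a≡y a≢y

addEdge-adj : ∀ {n} (G : Graph n) {x y} → x ≢ y → Adj (addEdge G x y) x y
addEdge-adj G {x} {y} x≢y with adj G x y | x ≟ x | y ≟ y | x ≟ y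
... | true  | _       | _       | _       = refl
... | false | yes _   | yes _   | no _    = refl
... | false | no x≢x  | _       | _       = contradiction refl x≢x
... | false | _       | no y≢y  | _       = contradiction refl y≢y
... | false | _       | _       | yes x≡y = contradiction x≡y x≢y

addEdge-mono : ∀ {n} {G G′ : Graph n} x y → G ⊑ G′ → addEdge G x y ⊑ addEdge G′ x y
addEdge-mono {G = G} {G′} x y G⊑G′ = ⊑-intro (λ {a b} new → lift a b new)
  where
  lift : ∀ a b → Adj (addEdge G x y) a b → Adj (addEdge G′ x y) a b
  lift a b new with addEdge-adj⁻ G x y a b new
  ... | inj₁ old                   = ⊑-adj (⊑-addEdge G′ x y) (⊑-adj G⊑G′ old)
  ... | inj₂ (inj₁ (refl , refl)) = addEdge-adj G′ (Adj⇒≢ (addEdge G x y) new)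
  ... | inj₂ (inj₂ (refl , refl)) =
    Adj-sym (addEdge G′ x y) (addEdge-adj G′ (Adj⇒≢ (addEdge G x y) (Adj-sym (addEdge G x y) new)))

Adj⇒∈Γ : ∀ {n} (G : Graph n) {v a} → Adj G v a → a ∈ Γ G v
Adj⇒∈Γ G {v} {a} e = lookup⇒[]= a (Γ G v) (trans (lookup∘tabulate (adj G v) a) e)

Γ≡⇒adj≡ : ∀ {n} (G : Graph n) {v w} → Γ G v ≡ Γ G w → ∀ a → adj G v a ≡ adj G w a
Γ≡⇒adj≡ G {v} {w} Γv≡Γw a = begin
  adj G v a          ≡⟨ lookup∘tabulate (adj G v) a ⟨
  lookup (Γ G v) a   ≡⟨ cong (λ N → lookup N a) Γv≡Γw ⟩
  lookup (Γ G w) a   ≡⟨ lookup∘tabulate (adj G w) a ⟩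
  adj G w a          ∎
  where open ≡-Reasoning

twins-nonadjacent : ∀ {n} (G : Graph n) {v w} → Γ G v ≡ Γ G w → ¬ Adj G v w
twins-nonadjacent G {v} {w} Γv≡Γw v~w =
  contradiction (trans (≡.sym v~w) (trans (Γ≡⇒adj≡ G Γv≡Γw w) (irrefl G w))) λ ()

deleteVertex : ∀ {n} → Graph (suc n) → Fin (suc n) → Graph n
deleteVertex H u = record
  { adj    = λ i j → adj H (punchIn u i) (punchIn u j)
  ; sym    = λ i j → Graph.sym H (punchIn u i) (punchIn u j)
  ; irrefl = λ i → irrefl H (punchIn u i)
  }

addEdge-deleteVertex : ∀ {n} (H : Graph (suc n)) u i j →
  deleteVertex (addEdge H (punchIn u i) (punchIn u j)) u ⊑ addEdge (deleteVertex H u) i j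
addEdge-deleteVertex H u i j = ⊑-intro λ {a b} → lower a b
  where
  lower : ∀ a b → Adj (addEdge H (punchIn u i) (punchIn u j)) (punchIn u a) (punchIn u b) →
          Adj (addEdge (deleteVertex H u) i j) a b
  lower a b new with addEdge-adj⁻ H (punchIn u i) (punchIn u j) (punchIn u a) (punchIn u b) new
  ... | inj₁ old = ⊑-adj (⊑-addEdge (deleteVertex H u) i j) old
  ... | inj₂ (inj₁ (a≡i , b≡j)) rewrite punchIn-injective u a i a≡i | punchIn-injective u b j b≡j =
    addEdge-adj (deleteVertex H u) (Adj⇒≢ (addEdge H _ _) new ∘ cong (punchIn u))
  ... | inj₂ (inj₂ (a≡j , b≡i)) rewrite punchIn-injective u a j a≡j | punchIn-injective u b i b≡i =
    Adj-sym (addEdge (deleteVertex H u) i j) (addEdge-adj (deleteVertex H u)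
      (Adj⇒≢ (addEdge H _ _) (Adj-sym (addEdge H _ _) new) ∘ cong (punchIn u)))

edgeIndicator : ∀ {n} → Graph n → Fin n → Fin n → ℕ
edgeIndicator G a b = indicator (⌊ a <? b ⌋ ∧ adj G a b)

edges≡∑∑ : ∀ {n} (G : Graph n) → edges G ≡ ∑[ a < n ] ∑[ b < n ] edgeIndicator G a b
edges≡∑∑ {n} G = begin
  edges G                             ≡⟨ cong ListAction.sum (map-tabulate id row) ⟩
  ListAction.sum (List.tabulate row)  ≡⟨ sum-tabulate row ⟩
  ∑[ a < n ] row a                    ≡⟨ sum-cong-≗ (λ a → ∣tabulate∣≡∑ (λ b → ⌊ a <? b ⌋ ∧ adj G a b)) ⟩
  ∑[ a < n ] ∑[ b < n ] edgeIndicator G a b ∎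
  where
  open ≡-Reasoning
  row : Fin n → ℕ
  row a = ∣ tabulate (λ b → ⌊ a <? b ⌋ ∧ adj G a b) ∣

edgeIndicator-addEdge : ∀ {n} (G : Graph n) x y a b →
  edgeIndicator (addEdge G x y) a b ≤
  edgeIndicator G a b + (indicator (⌊ a ≟ x ⌋ ∧ ⌊ b ≟ y ⌋) + indicator (⌊ a ≟ y ⌋ ∧ ⌊ b ≟ x ⌋))
edgeIndicator-addEdge G x y a b with ⌊ a <? b ⌋ | adj (addEdge G x y) a b in new
... | false | _     = z≤n
... | true  | false = z≤n
... | true  | true with addEdge-adj⁻ G x y a b new
...   | inj₁ old rewrite old = s≤s z≤n
...   | inj₂ (inj₁ (refl , refl)) rewrite ⌊⌋-yes (a ≟ a) refl | ⌊⌋-yes (b ≟ b) refl =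
  ≤-trans (m≤m+n 1 _) (m≤n+m _ (indicator (adj G a b)))
...   | inj₂ (inj₂ (refl , refl)) rewrite ⌊⌋-yes (a ≟ a) refl | ⌊⌋-yes (b ≟ b) refl =
  ≤-trans (m≤n+m 1 _) (m≤n+m _ (indicator (adj G a b)))

edges-addEdge : ∀ {n} (G : Graph n) x y → edges (addEdge G x y) ≤ edges G + 2
edges-addEdge {n} G x y = begin
  edges (addEdge G x y)               ≡⟨ edges≡∑∑ (addEdge G x y) ⟩
  ∑∑ (edgeIndicator (addEdge G x y))  ≤⟨ ∑-mono-≤ (λ a → ∑-mono-≤ (edgeIndicator-addEdge G x y a)) ⟩
  ∑∑ (λ a b → edgeIndicator G a b + (δ x y a b + δ y x a b))
    ≡⟨ ∑∑-distrib-+ (edgeIndicator G) (λ a b → δ x y a b + δ y x a b) ⟩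
  ∑∑ (edgeIndicator G) + ∑∑ (λ a b → δ x y a b + δ y x a b)
    ≡⟨ cong (∑∑ (edgeIndicator G) +_) (∑∑-distrib-+ (δ x y) (δ y x)) ⟩
  ∑∑ (edgeIndicator G) + (∑∑ (δ x y) + ∑∑ (δ y x))
    ≡⟨ cong₂ _+_ (≡.sym (edges≡∑∑ G)) (cong₂ _+_ (∑∑-indicator-≟ x y) (∑∑-indicator-≟ y x)) ⟩
  edges G + 2                         ∎
  where
  open ≤-Reasoning
  ∑∑ : (Fin n → Fin n → ℕ) → ℕ
  ∑∑ f = ∑[ a < n ] ∑[ b < n ] f a b
  δ : Fin n → Fin n → Fin n → Fin n → ℕ
  δ x y a b = indicator (⌊ a ≟ x ⌋ ∧ ⌊ b ≟ y ⌋)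

punchIn-mono-< : ∀ {n} (u : Fin (suc n)) {i j} → i Fin.< j → punchIn u i Fin.< punchIn u j
punchIn-mono-< u {i} {j} i<j = ≤∧≢⇒< (punchIn-mono-≤ u i j (<⇒≤ i<j)) (<⇒≢ i<j ∘ punchIn-injective u i j)

edgeIndicator-deleteVertex : ∀ {n} (H : Graph (suc n)) u i j →
  edgeIndicator (deleteVertex H u) i j ≤ edgeIndicator H (punchIn u i) (punchIn u j)
edgeIndicator-deleteVertex H u i j with i <? j
... | no _    = z≤n
... | yes i<j rewrite ⌊⌋-yes (punchIn u i <? punchIn u j) (punchIn-mono-< u i<j) = ≤-refl

edges-deleteVertex : ∀ {n} (H : Graph (suc n)) u → edges (deleteVertex H u) ≤ edges H
edges-deleteVertex {n} H u = begin
  edges (deleteVertex H u)                                          ≡⟨ edges≡∑∑ (deleteVertex H u) ⟩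
  ∑[ i < n ] ∑[ j < n ] edgeIndicator (deleteVertex H u) i j
    ≤⟨ ∑-mono-≤ (λ i → ∑-mono-≤ (edgeIndicator-deleteVertex H u i)) ⟩
  ∑[ i < n ] ∑[ j < n ] edgeIndicator H (punchIn u i) (punchIn u j)
    ≤⟨ ∑-mono-≤ (λ i → ∑-punchIn-≤ u (edgeIndicator H (punchIn u i))) ⟩
  ∑[ i < n ] ∑[ b < suc n ] edgeIndicator H (punchIn u i) b
    ≤⟨ ∑-punchIn-≤ u (λ a → ∑[ b < suc n ] edgeIndicator H a b) ⟩
  ∑[ a < suc n ] ∑[ b < suc n ] edgeIndicator H a b                 ≡⟨ edges≡∑∑ H ⟨
  edges H                                                           ∎
  where open ≤-Reasoning

IsClique : ∀ {n} → Graph n → Subset n → Set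
IsClique G K = ∀ x y → x ∈ K → y ∈ K → x ≢ y → Adj G x y

isClique? : ∀ {n} (G : Graph n) K → Dec (IsClique G K)
isClique? G K = all? λ x → all? λ y → x ∈? K →-dec y ∈? K →-dec ¬? (x ≟ y) →-dec adj G x y Bool.≟ true

hasClique? : ∀ {n} (G : Graph n) k X → Dec (HasClique G k X)
hasClique? G k X = anySubset? λ K → K ⊆? X ×-dec ∣ K ∣ ℕ.≟ k ×-dec isClique? G K

HasClique-mono : ∀ {n} {G G′ : Graph n} {k X} → G ⊑ G′ → HasClique G k X → HasClique G′ k X
HasClique-mono G⊑G′ (K , K⊆X , ∣K∣ , clique) =
  K , K⊆X , ∣K∣ , λ a b a∈K b∈K a≢b → ⊑-adj G⊑G′ (clique a b a∈K b∈K a≢b)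

IsClique-addEdge-∉ : ∀ {n} (G : Graph n) {x y K} → IsClique (addEdge G x y) K → x ∉ K ⊎ y ∉ K → IsClique G K
IsClique-addEdge-∉ G {x} {y} clique missing a b a∈K b∈K a≢b
  with addEdge-adj⁻ G x y a b (clique a b a∈K b∈K a≢b) | missing
... | inj₁ old                 | _        = old
... | inj₂ (inj₁ (refl , _))  | inj₁ x∉K = contradiction a∈K x∉K
... | inj₂ (inj₁ (_ , refl))  | inj₂ y∉K = contradiction b∈K y∉K
... | inj₂ (inj₂ (_ , refl))  | inj₁ x∉K = contradiction b∈K x∉K
... | inj₂ (inj₂ (refl , _))  | inj₂ y∉K = contradiction a∈K y∉K

IsClique-addEdge⁻ : ∀ {n} (G : Graph n) {x y K} → IsClique (addEdge G x y) K → IsClique G K ⊎ (x ∈ K × y ∈ K)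
IsClique-addEdge⁻ G {x} {y} {K} clique with x ∈? K | y ∈? K
... | yes x∈K | yes y∈K = inj₂ (x∈K , y∈K)
... | no x∉K  | _       = inj₁ (IsClique-addEdge-∉ G clique (inj₁ x∉K))
... | yes _   | no y∉K  = inj₁ (IsClique-addEdge-∉ G clique (inj₂ y∉K))

exchange : ∀ {n} → Subset n → Fin n → Fin n → Subset n
exchange K w v = (K [ w ]≔ outside) [ v ]≔ inside

module _ {n} (K : Subset n) (w v : Fin n) where

  ∉-exchange : v ≢ w → w ∉ exchange K w v
  ∉-exchange v≢w w∈ = ∉-[]≔-outside K w ([]=-[]≔⁻ (v≢w ∘ ≡.sym) w∈)

  ∈-exchange⁻ : ∀ {a} → a ∈ exchange K w v → a ≡ v ⊎ (a ≢ w × a ∈ K)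
  ∈-exchange⁻ {a} a∈ with a ≟ v | a ≟ w
  ... | yes a≡v | _       = inj₁ a≡v
  ... | no a≢v  | yes refl = contradiction ([]=-[]≔⁻ a≢v a∈) (∉-[]≔-outside K w)
  ... | no a≢v  | no a≢w  = inj₂ (a≢w , []=-[]≔⁻ a≢w ([]=-[]≔⁻ a≢v a∈))

  ∣exchange∣ : v ≢ w → w ∈ K → v ∉ K → ∣ exchange K w v ∣ ≡ ∣ K ∣
  ∣exchange∣ v≢w w∈K v∉K =
    trans (∣∣-[]≔-inside (K [ w ]≔ outside) v (v∉K ∘ []=-[]≔⁻ v≢w)) (∣∣-[]≔-outside w∈K)

  IsClique-exchange : ∀ (G : Graph n) → IsClique G K → w ∈ K → (∀ b → Adj G w b → Adj G v b) →
    IsClique G (exchange K w v)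
  IsClique-exchange G clique w∈K twin a b a∈ b∈ a≢b with ∈-exchange⁻ a∈ | ∈-exchange⁻ b∈
  ... | inj₁ refl         | inj₁ refl         = contradiction refl a≢b
  ... | inj₁ refl         | inj₂ (b≢w , b∈K) = twin b (clique w b w∈K b∈K (b≢w ∘ ≡.sym))
  ... | inj₂ (a≢w , a∈K) | inj₁ refl         = Adj-sym G (twin a (clique w a w∈K a∈K (a≢w ∘ ≡.sym)))
  ... | inj₂ (_ , a∈K)   | inj₂ (_ , b∈K)   = clique a b a∈K b∈K a≢b

module _ {n} (G : Graph (suc n)) (u : Fin (suc n)) {k : ℕ} where

  HasClique-lift : ∀ {Y : Subset n} {X} → (∀ {i} → i ∈ Y → punchIn u i ∈ X) →
    HasClique (deleteVertex G u) k Y → HasClique G k X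
  HasClique-lift {X = X} Y⇒X (K , K⊆Y , ∣K∣ , clique) =
    insertAt K u outside , K⁺⊆X , trans (∣insertAt-outside∣ {u = u} {K}) ∣K∣ , clique⁺
    where
    K⁺⊆X : insertAt K u outside ⊆ X
    K⁺⊆X a∈K⁺ with ∈-insertAt-outside⁻ a∈K⁺
    ... | i , refl , i∈K = Y⇒X (K⊆Y i∈K)
    clique⁺ : IsClique G (insertAt K u outside)
    clique⁺ a b a∈K⁺ b∈K⁺ a≢b with ∈-insertAt-outside⁻ a∈K⁺ | ∈-insertAt-outside⁻ b∈K⁺
    ... | i , refl , i∈K | j , refl , j∈K = clique i j i∈K j∈K (a≢b ∘ cong (punchIn u))

  HasClique-lower : ∀ {X} {Y : Subset n} → u ∉ X → (∀ {i} → punchIn u i ∈ X → i ∈ Y) →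
    HasClique G k X → HasClique (deleteVertex G u) k Y
  HasClique-lower u∉X X⇒Y (K , K⊆X , ∣K∣ , clique) =
    removeAt K u , X⇒Y ∘ K⊆X ∘ ∈-removeAt⁻ , trans (∣removeAt∣≡∣∣ (u∉X ∘ K⊆X)) ∣K∣ ,
    λ i j i∈K⁻ j∈K⁻ i≢j → clique _ _ (∈-removeAt⁻ i∈K⁻) (∈-removeAt⁻ j∈K⁻) (i≢j ∘ punchIn-injective u i j)

-- IsMaximalRSystem r H F unfolds to IsRSystem r H F × (every non-edge x y of H is Blocked).
Blocked : ∀ {n} → ℕ → Graph n → List (Subset n) → Fin n → Fin n → Set
Blocked {n} r G F x y =
  ContainsK (addEdge G x y) r ⊎ Σ (Subset n) λ S → S ∈ₗ F × HasClique (addEdge G x y) (r ∸ 1) S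

blocked? : ∀ {n} r (G : Graph n) F x y → Dec (Blocked r G F x y)
blocked? r G F x y =
  hasClique? (addEdge G x y) r full ⊎-dec
  map′ find (λ (S , S∈F , h) → lose S∈F h) (any? (hasClique? (addEdge G x y) (r ∸ 1)) F)

Blocked-mono : ∀ {n} r {G G′ : Graph n} F {x y} → G ⊑ G′ → Blocked r G F x y → Blocked r G′ F x y
Blocked-mono r F {x} {y} G⊑G′ (inj₁ Kr) =
  inj₁ (HasClique-mono (addEdge-mono x y G⊑G′) Kr)
Blocked-mono r F {x} {y} G⊑G′ (inj₂ (S , S∈F , Kr-1)) =
  inj₂ (S , S∈F , HasClique-mono (addEdge-mono x y G⊑G′) Kr-1)

-- Saturating an r-system

IsRSystem-addEdge : ∀ {n} {r} {G : Graph n} {F a b} → IsRSystem r G F → ¬ Blocked r G F a b →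
  IsRSystem r (addEdge G a b) F
IsRSystem-addEdge {G = G} {a = a} {b} R unblocked = record
  { noKr      = unblocked ∘ inj₁
  ; maxFree   = λ S S∈F → (λ Kr-1 → unblocked (inj₂ (S , S∈F , Kr-1))) ,
                          λ v v∉S → HasClique-mono (⊑-addEdge G a b) (proj₂ (maxFree R S S∈F) v v∉S)
  ; intersect = λ S T S∈F T∈F S≢T → HasClique-mono (⊑-addEdge G a b) (intersect R S T S∈F T∈F S≢T)
  }

UnblockedIn : ∀ {n} → ℕ → Graph n → List (Subset n) → List (Fin n × Fin n) → Set
UnblockedIn r G F L = ∀ x y → x ≢ y → ¬ Adj G x y → Blocked r G F x y ⊎ (x , y) ∈ₗ L

module _ {n} {r} {G : Graph n} {F a b L} (unblockedIn : UnblockedIn r G F ((a , b) ∷ L)) where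

  UnblockedIn-blocked : Blocked r G F a b → UnblockedIn r G F L
  UnblockedIn-blocked blocked x y x≢y ¬adj with unblockedIn x y x≢y ¬adj
  ... | inj₁ xy-blocked  = inj₁ xy-blocked
  ... | inj₂ (here refl) = inj₁ blocked
  ... | inj₂ (there xy∈L) = inj₂ xy∈L

  UnblockedIn-addEdge : UnblockedIn r (addEdge G a b) F L
  UnblockedIn-addEdge x y x≢y ¬adj with unblockedIn x y x≢y (¬adj ∘ ⊑-adj (⊑-addEdge G a b))
  ... | inj₁ xy-blocked   = inj₁ (Blocked-mono r F (⊑-addEdge G a b) xy-blocked)
  ... | inj₂ (here refl)  = contradiction (addEdge-adj G x≢y) ¬adj
  ... | inj₂ (there xy∈L) = inj₂ xy∈L

saturate : ∀ {n} {r} {G : Graph n} {F} → IsRSystem r G F → ∀ L → UnblockedIn r G F L →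
  Σ (Graph n) λ H′ → IsMaximalRSystem r H′ F × edges H′ ≤ edges G + length L * 2
saturate {G = G} R [] unblockedIn =
  G , (R , λ x y x≢y ¬adj → [ id , (λ ()) ] (unblockedIn x y x≢y ¬adj)) , m≤m+n (edges G) 0
saturate {r = r} {G} {F} R ((a , b) ∷ L) unblockedIn with blocked? r G F a b
... | yes blocked =
  let H′ , maximal , H′-edges = saturate R L (UnblockedIn-blocked {r = r} {G} {F} unblockedIn blocked)
  in  H′ , maximal , ≤-trans H′-edges (+-monoʳ-≤ (edges G) (m≤n+m (length L * 2) 2))
... | no unblocked =
  let H′ , maximal , H′-edges =
        saturate (IsRSystem-addEdge R unblocked) L (UnblockedIn-addEdge {r = r} {G} {F} unblockedIn)
  in  H′ , maximal , (begin
        edges H′                              ≤⟨ H′-edges ⟩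
        edges (addEdge G a b) + length L * 2  ≤⟨ +-monoˡ-≤ (length L * 2) (edges-addEdge G a b) ⟩
        edges G + 2 + length L * 2            ≡⟨ +-assoc (edges G) 2 (length L * 2) ⟩
        edges G + length ((a , b) ∷ L) * 2    ∎)
  where open ≤-Reasoning

-- Deleting a vertex

familyAvoiding : ∀ {n} → Fin (suc n) → List (Subset (suc n)) → List (Subset n)
familyAvoiding u F = List.map (λ S → removeAt S u) (filter (λ S → ¬? (u ∈? S)) F)

module _ {n} (u : Fin (suc n)) where

  ∈-familyAvoiding⁻ : ∀ {F T} → T ∈ₗ familyAvoiding u F → ∃ λ S → S ∈ₗ F × u ∉ S × T ≡ removeAt S u
  ∈-familyAvoiding⁻ T∈ with ∈-map⁻ (λ S → removeAt S u) T∈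
  ... | S , S∈F′ , refl = let S∈F , u∉S = ∈-filter⁻ (λ S → ¬? (u ∈? S)) S∈F′ in S , S∈F , u∉S , refl

  ∈-familyAvoiding⁺ : ∀ {F S} → S ∈ₗ F → u ∉ S → removeAt S u ∈ₗ familyAvoiding u F
  ∈-familyAvoiding⁺ S∈F u∉S = ∈-map⁺ (λ S → removeAt S u) (∈-filter⁺ (λ S → ¬? (u ∈? S)) S∈F u∉S)

  length-familyAvoiding : ∀ F → length (familyAvoiding u F) + s F u ≡ length F
  length-familyAvoiding F =
    trans (cong (_+ s F u) (length-map (λ S → removeAt S u) (filter (λ S → ¬? (u ∈? S)) F)))
          (length-filter-¬ (λ S → u ∈? S) F)

  Unique-familyAvoiding : ∀ {F} → Unique F → Unique (familyAvoiding u F)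
  Unique-familyAvoiding {F} unique =
    Unique-map⁺ removeAt-injective (Allₚ.all-filter (λ S → ¬? (u ∈? S)) F)
                                   (filter⁺ (λ S → ¬? (u ∈? S)) unique)

  ∣∣-familyAvoiding : ∀ {F t} → (∀ S → S ∈ₗ F → ∣ S ∣ ≡ t) → ∀ T → T ∈ₗ familyAvoiding u F → ∣ T ∣ ≡ t
  ∣∣-familyAvoiding sizes T T∈ with ∈-familyAvoiding⁻ T∈
  ... | S , S∈F , u∉S , refl = trans (∣removeAt∣≡∣∣ u∉S) (sizes S S∈F)

s≡0⇒∉ : ∀ {n} {F : List (Subset n)} {u S} → s F u ≡ 0 → S ∈ₗ F → u ∉ S
s≡0⇒∉ {F = F} {u} s≡0 S∈F u∈S with filter (λ S → u ∈? S) F | ∈-filter⁺ (λ S → u ∈? S) S∈F u∈S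
... | _ ∷ _ | _ = contradiction s≡0 λ ()

IsRSystem-deleteVertex : ∀ {n r} {H : Graph (suc n)} {F} u → IsRSystem r H F →
  IsRSystem r (deleteVertex H u) (familyAvoiding u F)
IsRSystem-deleteVertex {r = r} {H} {F} u R = record
  { noKr      = noKr R ∘ HasClique-lift H u (λ _ → ∈-full)
  ; maxFree   = maxFree⁻
  ; intersect = intersect⁻
  }
  where
  maxFree⁻ : ∀ T → T ∈ₗ familyAvoiding u F → MaxKFree (deleteVertex H u) (r ∸ 1) T
  maxFree⁻ T T∈ with ∈-familyAvoiding⁻ u T∈
  ... | S , S∈F , u∉S , refl = proj₁ (maxFree R S S∈F) ∘ HasClique-lift H u ∈-removeAt⁻ , saturated
    where
    saturated : ∀ i → i ∉ removeAt S u → HasClique (deleteVertex H u) (r ∸ 1) (removeAt S u ∪ ⁅ i ⁆)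
    saturated i i∉S⁻ =
      HasClique-lower H u u∉S∪i ∈-removeAt-∪-⁅⁆ (proj₂ (maxFree R S S∈F) (punchIn u i) (i∉S⁻ ∘ ∈-removeAt⁺))
      where
      u∉S∪i : u ∉ S ∪ ⁅ punchIn u i ⁆
      u∉S∪i u∈ = [ u∉S , punchInᵢ≢i u i ∘ ≡.sym ∘ x∈⁅y⁆⇒x≡y _ ] (x∈p∪q⁻ S _ u∈)
  intersect⁻ : ∀ T T′ → T ∈ₗ familyAvoiding u F → T′ ∈ₗ familyAvoiding u F → T ≢ T′ →
               HasClique (deleteVertex H u) (r ∸ 2) (T ∩ T′)
  intersect⁻ T T′ T∈ T′∈ T≢T′ with ∈-familyAvoiding⁻ u T∈ | ∈-familyAvoiding⁻ u T′∈
  ... | S , S∈F , u∉S , refl | S′ , S′∈F , _ , refl =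
    HasClique-lower H u (u∉S ∘ proj₁ ∘ x∈p∩q⁻ S S′) ∈-removeAt-∩
      (intersect R S S′ S∈F S′∈F (T≢T′ ∘ cong (λ S → removeAt S u)))

module Deletion {n} {r : ℕ} (H : Graph (suc n)) (F : List (Subset (suc n))) (u : Fin (suc n)) where

  u≢punchIn : ∀ i → u ≢ punchIn u i
  u≢punchIn i = punchInᵢ≢i u i ∘ ≡.sym

  module _ {i j : Fin n} where

    Blocked-lowerClique : ∀ {K} → IsClique (addEdge H (punchIn u i) (punchIn u j)) K → ∣ K ∣ ≡ r → u ∉ K →
      Blocked r (deleteVertex H u) (familyAvoiding u F) i j
    Blocked-lowerClique {K} clique ∣K∣ u∉K =
      inj₁ (HasClique-mono (addEdge-deleteVertex H u i j)
             (HasClique-lower (addEdge H _ _) u u∉K (λ _ → ∈-full) (K , id , ∣K∣ , clique)))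

    Blocked-lowerSet : ∀ {S} → S ∈ₗ F → u ∉ S → HasClique (addEdge H (punchIn u i) (punchIn u j)) (r ∸ 1) S →
      Blocked r (deleteVertex H u) (familyAvoiding u F) i j
    Blocked-lowerSet {S} S∈F u∉S Kr-1 =
      inj₂ (removeAt S u , ∈-familyAvoiding⁺ u S∈F u∉S ,
            HasClique-mono (addEdge-deleteVertex H u i j)
              (HasClique-lower (addEdge H _ _) u u∉S ∈-removeAt⁺ Kr-1))

  coMembers : List (Fin n)
  coMembers = concatMap (λ Z → elements (removeAt Z u)) (Γ H u ∷ filter (λ S → u ∈? S) F)

  ∈-coMembers : ∀ {Z a} → Z ∈ₗ Γ H u ∷ filter (λ S → u ∈? S) F → punchIn u a ∈ Z → a ∈ₗ coMembers
  ∈-coMembers Z∈ a∈Z =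
    ∈-concat⁺′ (∈-elements (∈-removeAt⁺ a∈Z)) (∈-map⁺ (λ Z → elements (removeAt Z u)) Z∈)

  length-coMembers : ∀ {t} → deg H u ≤ t → (∀ S → S ∈ₗ F → ∣ S ∣ ≡ t) → length coMembers ≤ suc (s F u) * t
  length-coMembers {t} deg≤t sizes =
    length-concatMap-≤ (λ Z → elements (removeAt Z u)) (Γ H u ∷ filter (λ S → u ∈? S) F)
      (bound (Γ H u) deg≤t ∷ All.tabulate λ {S} S∈ →
         bound S (≤-reflexive (sizes S (proj₁ (∈-filter⁻ (λ S → u ∈? S) S∈)))))
    where
    bound : ∀ Z → ∣ Z ∣ ≤ t → length (elements (removeAt Z u)) ≤ t
    bound Z ∣Z∣≤t = begin
      length (elements (removeAt Z u))  ≡⟨ length-elements (removeAt Z u) ⟩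
      ∣ removeAt Z u ∣                  ≤⟨ ∣removeAt∣≤∣∣ Z u ⟩
      ∣ Z ∣                             ≤⟨ ∣Z∣≤t ⟩
      t                                 ∎
      where open ≤-Reasoning

  module _ (R : IsRSystem r H F) {i j : Fin n} where

    private
      Outcome : Set
      Outcome = Blocked r (deleteVertex H u) (familyAvoiding u F) i j ⊎
                (i , j) ∈ₗ cartesianProduct coMembers coMembers

    lowDegree-clique : ∀ {K} → IsClique (addEdge H (punchIn u i) (punchIn u j)) K → ∣ K ∣ ≡ r → Outcome
    lowDegree-clique {K} clique ∣K∣ with IsClique-addEdge⁻ H clique
    ... | inj₁ old = ⊥-elim (noKr R (K , ⊆-full , ∣K∣ , old))
    ... | inj₂ (i∈K , j∈K) with u ∈? K
    ...   | no u∉K  = inj₁ (Blocked-lowerClique clique ∣K∣ u∉K)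
    ...   | yes u∈K = inj₂ (∈-cartesianProduct⁺ (neighbour i∈K) (neighbour j∈K))
      where
      neighbour : ∀ {a} → punchIn u a ∈ K → a ∈ₗ coMembers
      neighbour {a} a∈K = ∈-coMembers (here refl)
        (Adj⇒∈Γ H (addEdge-adj⁻-≢ H _ (u≢punchIn i) (u≢punchIn j) (clique u _ u∈K a∈K (u≢punchIn a))))

    lowDegree-set : ∀ {S} → S ∈ₗ F → HasClique (addEdge H (punchIn u i) (punchIn u j)) (r ∸ 1) S → Outcome
    lowDegree-set {S} S∈F (K , K⊆S , ∣K∣ , clique) with IsClique-addEdge⁻ H clique
    ... | inj₁ old = ⊥-elim (proj₁ (maxFree R S S∈F) (K , K⊆S , ∣K∣ , old))
    ... | inj₂ (i∈K , j∈K) with u ∈? S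
    ...   | no u∉S  = inj₁ (Blocked-lowerSet S∈F u∉S (K , K⊆S , ∣K∣ , clique))
    ...   | yes u∈S = inj₂ (∈-cartesianProduct⁺ (member i∈K) (member j∈K))
      where
      member : ∀ {a} → punchIn u a ∈ K → a ∈ₗ coMembers
      member a∈K = ∈-coMembers (there (∈-filter⁺ (λ S → u ∈? S) S∈F u∈S)) (K⊆S a∈K)

  lowDegree-unblockedIn : IsMaximalRSystem r H F →
    UnblockedIn r (deleteVertex H u) (familyAvoiding u F) (cartesianProduct coMembers coMembers)
  lowDegree-unblockedIn (R , maximal) i j i≢j ¬adj
    with maximal (punchIn u i) (punchIn u j) (i≢j ∘ punchIn-injective u i j) ¬adj
  ... | inj₁ (K , _ , ∣K∣ , clique) = lowDegree-clique R clique ∣K∣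
  ... | inj₂ (S , S∈F , Kr-1)       = lowDegree-set R S∈F Kr-1

  twin-unblockedIn : ∀ {v} → IsMaximalRSystem r H F → v ≢ u → Γ H v ≡ Γ H u → s F u ≡ 0 →
    UnblockedIn r (deleteVertex H u) (familyAvoiding u F) []
  twin-unblockedIn {v} (R , maximal) v≢u Γv≡Γu s≡0 i j i≢j ¬adj
    with maximal (punchIn u i) (punchIn u j) (i≢j ∘ punchIn-injective u i j) ¬adj
  ... | inj₂ (S , S∈F , Kr-1) = inj₁ (Blocked-lowerSet S∈F (s≡0⇒∉ s≡0 S∈F) Kr-1)
  ... | inj₁ (K , _ , ∣K∣ , clique) with u ∈? K
  ...   | no u∉K  = inj₁ (Blocked-lowerClique clique ∣K∣ u∉K)
  ...   | yes u∈K = inj₁ (Blocked-lowerClique (IsClique-exchange K u v H⁺ clique u∈K twin)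
                                              (trans (∣exchange∣ K u v v≢u u∈K v∉K) ∣K∣)
                                              (∉-exchange K u v v≢u))
    where
    H⁺ = addEdge H (punchIn u i) (punchIn u j)
    old : ∀ {b} → Adj H⁺ u b → Adj H u b
    old = addEdge-adj⁻-≢ H _ (u≢punchIn i) (u≢punchIn j)
    twin : ∀ b → Adj H⁺ u b → Adj H⁺ v b
    twin b u~b = ⊑-adj (⊑-addEdge H _ _) (trans (Γ≡⇒adj≡ H Γv≡Γu b) (old u~b))
    v∉K : v ∉ K
    v∉K v∈K = twins-nonadjacent H Γv≡Γu (Adj-sym H (old (clique u v u∈K v∈K (v≢u ∘ ≡.sym))))

-- The two reductions

Reduction : ∀ {n} → ℕ → ℕ → ℕ → Graph (suc n) → List (Subset (suc n)) → Set
Reduction {n} r t C H F =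
  Σ (Graph n) λ H′ → Σ (List (Subset n)) λ F′ →
    IsMaximalRTSystem r t H′ F′ × (edges H′ ≤ edges H + C) ×
    (length F ∸ C ≤ length F′) × (length F′ ≤ length F)

m+n≡o∧n≤p⇒o∸p≤m : ∀ {m n o p} → m + n ≡ o → n ≤ p → o ∸ p ≤ m
m+n≡o∧n≤p⇒o∸p≤m {m} {n} refl n≤p = ≤-trans (∸-monoʳ-≤ (m + n) n≤p) (≤-reflexive (m+n∸n≡m m n))

deletion-reduction : ∀ {n r t C} {H : Graph (suc n)} {F} u L → IsMaximalRTSystem r t H F →
  UnblockedIn r (deleteVertex H u) (familyAvoiding u F) L → s F u ≤ C → length L * 2 ≤ C →
  Reduction r t C H F
deletion-reduction {H = H} {F} u L ((R , _) , unique , sizes) unblockedIn s≤C L≤C =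
  let H′ , maximal , H′-edges = saturate (IsRSystem-deleteVertex u R) L unblockedIn
  in  H′ , familyAvoiding u F ,
      (maximal , Unique-familyAvoiding u unique , ∣∣-familyAvoiding u sizes) ,
      ≤-trans H′-edges (+-mono-≤ (edges-deleteVertex H u) L≤C) ,
      m+n≡o∧n≤p⇒o∸p≤m (length-familyAvoiding u F) s≤C ,
      ≤-trans (m≤m+n _ (s F u)) (≤-reflexive (length-familyAvoiding u F))

-- t pays for the s(v) ≤ t lost sets, and each of the at most ((1 + t)t)² candidate pairs
-- adds at most 2 to the edge count (edges-addEdge).
lowDegreeCost : ℕ → ℕ
lowDegreeCost t = t + suc t * t * (suc t * t) * 2

lowDegree-reduction : ∀ {n r t} {H : Graph (suc n)} {F} {v} → IsMaximalRTSystem r t H F →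
  deg H v + s F v ≤ t → Reduction r t (lowDegreeCost t) H F
lowDegree-reduction {t = t} {H} {F} {v} M@(maximal , _ , sizes) small =
  deletion-reduction v (cartesianProduct coMembers coMembers) M (lowDegree-unblockedIn maximal)
    (≤-trans s≤t (m≤m+n t _)) (≤-trans pairs≤ (m≤n+m _ t))
  where
  open Deletion H F v
  s≤t : s F v ≤ t
  s≤t = ≤-trans (m≤n+m (s F v) (deg H v)) small
  ∣coMembers∣≤ : length coMembers ≤ suc t * t
  ∣coMembers∣≤ = ≤-trans (length-coMembers (≤-trans (m≤m+n (deg H v) (s F v)) small) sizes)
                         (*-mono-≤ (s≤s s≤t) ≤-refl)
  pairs≤ : length (cartesianProduct coMembers coMembers) * 2 ≤ suc t * t * (suc t * t) * 2
  pairs≤ = *-mono-≤ (≤-trans (≤-reflexive (length-cartesianProduct coMembers coMembers))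
                             (*-mono-≤ ∣coMembers∣≤ ∣coMembers∣≤)) ≤-refl

twin-reduction : ∀ {n r t C} {H : Graph (suc n)} {F} {v w} → IsMaximalRTSystem r t H F →
  v ≢ w → Γ H v ≡ Γ H w → s F w ≡ 0 → Reduction r t C H F
twin-reduction {H = H} {F} {w = w} M@(maximal , _ , _) v≢w Γv≡Γw s≡0 =
  deletion-reduction w [] M (Deletion.twin-unblockedIn H F w maximal v≢w Γv≡Γw s≡0)
    (≤-trans (≤-reflexive s≡0) z≤n) z≤n

lemma40 : (r t : ℕ) → 3 ≤ r → r ∸ 2 ≤ t →
    Σ ℕ λ C →
      ∀ (n : ℕ) (H : Graph (suc n)) (F : List (Subset (suc n))) →
      IsMaximalRTSystem r t H F →
      ((Σ (Fin (suc n)) λ v → deg H v + s F v ≤ t) ⊎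
       (Σ (Fin (suc n)) λ v → Σ (Fin (suc n)) λ w →
          (v ≢ w) × (s F v ≡ 0) × (s F w ≡ 0) × (Γ H v ≡ Γ H w))) →
      Σ (Graph n) λ H′ → Σ (List (Subset n)) λ F′ →
        IsMaximalRTSystem r t H′ F′ ×
        (edges H′ ≤ edges H + C) ×
        (length F ∸ C ≤ length F′) × (length F′ ≤ length F)
lemma40 r t _ _ = lowDegreeCost t , λ where
  n H F M (inj₁ (v , small))                       → lowDegree-reduction M small
  n H F M (inj₂ (v , w , v≢w , _ , s≡0 , Γv≡Γw)) → twin-reduction M v≢w Γv≡Γw s≡0
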